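{- Let $n\ge 1$ and let $\mathcal{A}_n=\{(ij|K): K\subseteq[n],\ i\neq j\in[n]\setminus K\}$, where $(ij|K)$ and $(ji|K)$ denote the same element. For a matroid $M$ on $[n]$ with rank function $r$ put \[[[M]]=\{(ij|K)\in\mathcal{A}_n: r(iK)+r(jK)=r(ijK)+r(K)\}.\] A subset $\mathcal{G}\subseteq\mathcal{A}_n$ satisfies $\mathcal{G}=[[M]]$ for some loopless matroid $M$ on $[n]$ if and only if $\mathcal{G}$ satisfies both of the following conditions: (MCI) for all pairwise distinct $i,j,\ell\in[n]$ and all disjoint $K,L\subseteq[n]\setminus\{i,j,\ell\}$: if $(ij|K)\notin\mathcal{G}$, then $(i\ell|jKL)\in\mathcal{G}$; (SG) for all pairwise distinct $i,j,\ell\in[n]$ and all $K\subseteq[n]\setminus\{i,j,\ell\}$: if $(ij|K)\in\mathcal{G}$ and $(i\ell|jK)\in\mathcal{G}$, then $(i\ell|K)\in\mathcal{G}$ and $(ij|\ell K)\in\mathcal{G}$. Moreover, the map $M\mapsto[[M]]$ is a bijection from the set of loopless matroids on $[n]$ to the set of subsets of $\mathcal{A}_n$ satisfying (MCI) and (SG).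
   Context: Notation: concatenation of letters denotes disjoint union of sets; lower-case letters denote singletons, upper-case letters denote (possibly empty) subsets. Thus $iK=\{i\}\cup K$, $ijK=\{i,j\}\cup K$, $jKL=\{j\}\cup K\cup L$, etc., with all the indicated sets pairwise disjoint. A matroid is loopless if it has no loop (no element $e$ with $r(\{e\})=0$). -}

module Defs where

open import Data.Nat using (ℕ; _+_; _≤_)
open import Data.Bool using (Bool; true; false)
open import Data.Fin using (Fin)
open import Data.Fin.Subset using (Subset; _∈_; _∉_; _⊆_; _∪_; _∩_; ⁅_⁆; ∣_∣)
open import Data.Product using (_×_)
open import Relation.Binary.PropositionalEquality using (_≡_; _≢_)
open import Relation.Nullary using (¬_)

record Matroid (n : ℕ) : Set where
  field
    r       : Subset n → ℕ
    r-bound : ∀ X → r X ≤ ∣ X ∣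
    r-mono  : ∀ {X Y} → X ⊆ Y → r X ≤ r Y
    r-sub   : ∀ X Y → r (X ∪ Y) + r (X ∩ Y) ≤ r X + r Y
open Matroid public

Loopless : ∀ {n} → Matroid n → Set
Loopless M = ∀ e → ¬ (r M ⁅ e ⁆ ≡ 0)

Valid : ∀ {n} → Fin n → Fin n → Subset n → Set
Valid i j K = i ≢ j × i ∉ K × j ∉ K

InCI : ∀ {n} → Matroid n → Fin n → Fin n → Subset n → Set
InCI M i j K =
  r M (⁅ i ⁆ ∪ K) + r M (⁅ j ⁆ ∪ K) ≡ r M (⁅ i ⁆ ∪ ⁅ j ⁆ ∪ K) + r M K

-- A subset G of A_n is represented by a Bool-valued function on triples
-- (i, j, K); only its values on valid triples matter, and it must not
-- distinguish (ij|K) from (ji|K).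
Family : ℕ → Set
Family n = Fin n → Fin n → Subset n → Bool

SymFamily : ∀ {n} → Family n → Set
SymFamily G = ∀ i j K → Valid i j K → G i j K ≡ G j i K

Represents : ∀ {n} → Family n → Matroid n → Set
Represents G M = ∀ i j K → Valid i j K →
  (G i j K ≡ true → InCI M i j K) × (InCI M i j K → G i j K ≡ true)

Distinct3 : ∀ {n} → Fin n → Fin n → Fin n → Set
Distinct3 i j l = i ≢ j × i ≢ l × j ≢ l

Avoids3 : ∀ {n} → Fin n → Fin n → Fin n → Subset n → Set
Avoids3 i j l K = i ∉ K × j ∉ K × l ∉ K

MCI : ∀ {n} → Family n → Set
MCI G = ∀ i j l K L → Distinct3 i j l → Avoids3 i j l K → Avoids3 i j l L →
  (∀ x → x ∈ K → x ∉ L) →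
  G i j K ≡ false → G i l (⁅ j ⁆ ∪ K ∪ L) ≡ true

SG : ∀ {n} → Family n → Set
SG G = ∀ i j l K → Distinct3 i j l → Avoids3 i j l K →
  G i j K ≡ true → G i l (⁅ j ⁆ ∪ K) ≡ true →
  G i l K ≡ true × G i j (⁅ l ⁆ ∪ K) ≡ true

-- Write cl(K) = {i : r(iK) = r(K)}. Since r(iK) − r(K) ∈ {0, 1} and this increment
-- can only drop as K grows, (ij|K) ∈ [[M]] says exactly that adding j to K does not
-- bring i into cl(K). In this form (MCI) and (SG) follow from the monotonicity of
-- closure, and uniqueness follows by induction on K: r(ijK) is determined by r(iK),
-- r(jK), r(K) when (ij|K) ∈ [[M]], and equals r(jK) otherwise.
--
-- Conversely, given G, let i depend on K when some (ij|K′) ∉ G has j ∈ K and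
-- K′ ⊆ K ∖ j. (MCI) shows that (ij|K) ∉ G makes i independent of K, and (SG) pushes
-- (ij|K′) ∉ G up to every K ⊇ K′ of which i is independent. Together these give
-- transitivity and the Mac Lane–Steinitz exchange property of dependence, which is
-- what makes r(X) = Σ_{x ∈ X} δ(x, elements of X added before x), with δ = 0 on
-- dependent and 1 on independent pairs, independent of the order of addition. The
-- rank axioms and r(iK) = r(K) + δ(i, K) then give [[M]] = G.
module Submission where

open import Defs
open import Algebra.Bundles using (CommutativeMonoid)
open import Data.Bool using (true; false)
open import Data.Empty using (⊥-elim)
open import Data.Fin using (Fin) renaming (_≟_ to _≟ᶠ_)
open import Data.Fin.Properties using (any?)
open import Data.Fin.Subset
open import Data.Fin.Subset.Induction using (⊂-wellFounded; Acc; acc)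
open import Data.Fin.Subset.Properties
open import Data.List.Base using (List; []; _∷_; allFin)
open import Data.List.Membership.Propositional using () renaming (_∈_ to _∈ₗ_)
open import Data.List.Membership.Propositional.Properties using (∈-allFin)
open import Data.List.Relation.Unary.Any using (here; there)
open import Data.Vec.Base using (_∷_; here; there)
open import Data.Nat using (ℕ; zero; suc; _+_; _≤_; z≤n; s≤s)
open import Data.Nat.Properties
open import Data.Product using (Σ; _×_; _,_; proj₁; proj₂)
open import Function using (_∘_; id; case_of_)
open import Data.Sum using (inj₁; inj₂; [_,_])
open import Relation.Binary.PropositionalEquality hiding ([_])
open import Relation.Nullary using (¬_; Dec; yes; no)
open import Relation.Nullary.Decidable using (_×-dec_; ¬?)
import Data.Bool.Properties as Bool
open import Algebra.Properties.CommutativeSemigroup +-commutativeSemigroup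
  using (xy∙z≈xz∙y)

true≢false : true ≢ false
true≢false ()

x∈p─q⇒x∉q : ∀ {n} {x : Fin n} (p q : Subset n) → x ∈ p ─ q → x ∉ q
x∈p─q⇒x∉q (_ ∷ p) (true  ∷ q) ()        here
x∈p─q⇒x∉q (_ ∷ p) (false ∷ q) here      ()
x∈p─q⇒x∉q (_ ∷ p) (_     ∷ q) (there h) (there h′) = x∈p─q⇒x∉q p q h h′

module _ {n : ℕ} where

  open import Algebra.Properties.CommutativeSemigroup
    (CommutativeMonoid.commutativeSemigroup (∪-commutativeMonoid n))
    using () renaming (x∙yz≈y∙xz to ∪-swap) public

  private variable
    x y : Fin n
    p q : Subset n

  x∈p─q⁻ : x ∈ p ─ q → x ∈ p × x ∉ q
  x∈p─q⁻ {p = p} {q} h = p─q⊆p p q h , x∈p─q⇒x∉q p q h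

  x∉p-x : x ∉ p - x
  x∉p-x {x} {p} h = x∈p─q⇒x∉q p ⁅ x ⁆ h (x∈⁅x⁆ x)

  x∈⁅x⁆∪p : (x : Fin n) (p : Subset n) → x ∈ ⁅ x ⁆ ∪ p
  x∈⁅x⁆∪p x p = x∈p∪q⁺ (inj₁ (x∈⁅x⁆ x))

  x∉p∪q⁺ : x ∉ p → x ∉ q → x ∉ p ∪ q
  x∉p∪q⁺ {p = p} {q} x∉p x∉q h = [ x∉p , x∉q ] (x∈p∪q⁻ p q h)

  x∉⁅y⁆∪p⁺ : x ≢ y → x ∉ p → x ∉ ⁅ y ⁆ ∪ p
  x∉⁅y⁆∪p⁺ x≢y = x∉p∪q⁺ (x≢y⇒x∉⁅y⁆ x≢y)

  x∈p∧y∉p⇒x≢y : x ∈ p → y ∉ p → x ≢ y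
  x∈p∧y∉p⇒x≢y x∈p y∉p refl = y∉p x∈p

  ∪-monoʳ-⊆ : (s : Subset n) → p ⊆ q → s ∪ p ⊆ s ∪ q
  ∪-monoʳ-⊆ {p} s p⊆q h = [ p⊆p∪q _ , (λ h′ → q⊆p∪q s _ (p⊆q h′)) ] (x∈p∪q⁻ s p h)

  ⁅x⁆∪p⊆q : x ∈ q → p ⊆ q → ⁅ x ⁆ ∪ p ⊆ q
  ⁅x⁆∪p⊆q {x} {q} {p} x∈q p⊆q h =
    [ (λ h′ → subst (_∈ q) (sym (x∈⁅y⁆⇒x≡y x h′)) x∈q) , p⊆q ] (x∈p∪q⁻ ⁅ x ⁆ p h)

  x∈⁅y⁆∪p∧x≢y⇒x∈p : x ∈ ⁅ y ⁆ ∪ p → x ≢ y → x ∈ p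
  x∈⁅y⁆∪p∧x≢y⇒x∈p {x} {y} {p} h x≢y =
    [ ⊥-elim ∘ x≢y ∘ x∈⁅y⁆⇒x≡y y , id ] (x∈p∪q⁻ ⁅ y ⁆ p h)

  p⊆⁅x⁆∪q∧x∉p⇒p⊆q : p ⊆ ⁅ x ⁆ ∪ q → x ∉ p → p ⊆ q
  p⊆⁅x⁆∪q∧x∉p⇒p⊆q p⊆ x∉p y∈p = x∈⁅y⁆∪p∧x≢y⇒x∈p (p⊆ y∈p) (x∈p∧y∉p⇒x≢y y∈p x∉p)

  p⊆q⇒p∪[q─p]≡q : p ⊆ q → p ∪ (q ─ p) ≡ q
  p⊆q⇒p∪[q─p]≡q {p} {q} p⊆q = ⊆-antisym
    (λ h → [ p⊆q , proj₁ ∘ x∈p─q⁻ ] (x∈p∪q⁻ p (q ─ p) h))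
    (λ {y} y∈q → case y ∈? p of λ where
      (yes y∈p) → p⊆p∪q _ y∈p
      (no  y∉p) → q⊆p∪q p _ (x∈p∧x∉q⇒x∈p─q y∈q y∉p))

  x∈p⇒⁅x⁆∪[p-x]≡p : x ∈ p → ⁅ x ⁆ ∪ (p - x) ≡ p
  x∈p⇒⁅x⁆∪[p-x]≡p {x} {p} x∈p = p⊆q⇒p∪[q─p]≡q ⁅x⁆⊆p
    where
    ⁅x⁆⊆p : ⁅ x ⁆ ⊆ p
    ⁅x⁆⊆p h = subst (_∈ p) (sym (x∈⁅y⁆⇒x≡y x h)) x∈p

  x∉p⇒[⁅x⁆∪p]-x≡p : x ∉ p → (⁅ x ⁆ ∪ p) - x ≡ p
  x∉p⇒[⁅x⁆∪p]-x≡p {x} {p} x∉p = ⊆-antisym ⊆p p⊆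
    where
    ⊆p : (⁅ x ⁆ ∪ p) - x ⊆ p
    ⊆p h = x∈⁅y⁆∪p∧x≢y⇒x∈p (proj₁ (x∈p─q⁻ h)) (x∉⁅y⁆⇒x≢y (proj₂ (x∈p─q⁻ h)))
    p⊆ : p ⊆ (⁅ x ⁆ ∪ p) - x
    p⊆ y∈p = x∈p∧x≢y⇒x∈p-y (q⊆p∪q ⁅ x ⁆ p y∈p) (x∈p∧y∉p⇒x≢y y∈p x∉p)

  x≢y⇒[⁅y⁆∪p]-x≡⁅y⁆∪[p-x] : x ≢ y → (⁅ y ⁆ ∪ p) - x ≡ ⁅ y ⁆ ∪ (p - x)
  x≢y⇒[⁅y⁆∪p]-x≡⁅y⁆∪[p-x] {x} {y} {p} x≢y = ⊆-antisym ⊆ʳ ⊆ˡ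
    where
    ⊆ʳ : (⁅ y ⁆ ∪ p) - x ⊆ ⁅ y ⁆ ∪ (p - x)
    ⊆ʳ h with x∈p─q⁻ h
    ... | z∈⁅y⁆∪p , z∉⁅x⁆ = [ p⊆p∪q _ , (λ z∈p → q⊆p∪q ⁅ y ⁆ _ (x∈p∧x∉q⇒x∈p─q z∈p z∉⁅x⁆)) ]
                              (x∈p∪q⁻ ⁅ y ⁆ p z∈⁅y⁆∪p)
    ⊆ˡ : ⁅ y ⁆ ∪ (p - x) ⊆ (⁅ y ⁆ ∪ p) - x
    ⊆ˡ h with x∈p∪q⁻ ⁅ y ⁆ (p - x) h
    ... | inj₁ z∈⁅y⁆ = x∈p∧x∉q⇒x∈p─q (p⊆p∪q p z∈⁅y⁆)
                         (λ z∈⁅x⁆ → x≢y (trans (sym (x∈⁅y⁆⇒x≡y x z∈⁅x⁆)) (x∈⁅y⁆⇒x≡y y z∈⁅y⁆)))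
    ... | inj₂ z∈p-x with x∈p─q⁻ z∈p-x
    ...   | z∈p , z∉⁅x⁆ = x∈p∧x∉q⇒x∈p─q (q⊆p∪q ⁅ y ⁆ p z∈p) z∉⁅x⁆

  ⊆-induction : (P : Subset n → Set) {A B : Subset n} → A ⊆ B → P A →
    (∀ {l S} → A ⊆ S → S ⊆ B → l ∈ B → l ∉ S → P S → P (⁅ l ⁆ ∪ S)) → P B
  ⊆-induction P {A} {B} A⊆B PA step = go B (⊂-wellFounded B) A⊆B ⊆-refl
    where
    go : ∀ C → Acc _⊂_ C → A ⊆ C → C ⊆ B → P C
    go C (acc rec) A⊆C C⊆B with nonempty? (C ─ A)
    ... | yes (l , l∈C─A) = subst P (x∈p⇒⁅x⁆∪[p-x]≡p l∈C)
            (step A⊆C-l C-l⊆B (C⊆B l∈C) x∉p-x (go (C - l) (rec (x∈p⇒p-x⊂p l∈C)) A⊆C-l C-l⊆B))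
      where
      l∈C = proj₁ (x∈p─q⁻ l∈C─A)
      A⊆C-l : A ⊆ C - l
      A⊆C-l y∈A = x∈p∧x≢y⇒x∈p-y (A⊆C y∈A) (x∈p∧y∉p⇒x≢y y∈A (proj₂ (x∈p─q⁻ l∈C─A)))
      C-l⊆B : C - l ⊆ B
      C-l⊆B h = C⊆B (p─q⊆p C ⁅ l ⁆ h)
    ... | no C─A-empty = subst P (⊆-antisym A⊆C C⊆A) PA
      where
      C⊆A : C ⊆ A
      C⊆A {y} y∈C with y ∈? A
      ... | yes y∈A = y∈A
      ... | no  y∉A = ⊥-elim (C─A-empty (y , x∈p∧x∉q⇒x∈p─q y∈C y∉A))

module _ {n : ℕ} (M : Matroid n) where

  Spans : Subset n → Fin n → Set
  Spans K i = r M (⁅ i ⁆ ∪ K) ≡ r M K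

  spans? : ∀ K i → Dec (Spans K i)
  spans? K i = r M (⁅ i ⁆ ∪ K) ≟ r M K

  r-⊥ : r M ⊥ ≡ 0
  r-⊥ = n≤0⇒n≡0 (≤-trans (r-bound M ⊥) (≤-reflexive (∣⊥∣≡0 n)))

  r-⁅x⁆≡1 : Loopless M → ∀ i → r M ⁅ i ⁆ ≡ 1
  r-⁅x⁆≡1 loopless i
    with r M ⁅ i ⁆ | subst (r M ⁅ i ⁆ ≤_) (∣⁅x⁆∣≡1 i) (r-bound M ⁅ i ⁆) | loopless i
  ... | zero  | _       | r≢0 = ⊥-elim (r≢0 refl)
  ... | suc _ | s≤s r≤0 | _   = cong suc (n≤0⇒n≡0 r≤0)

  r-insert-mono : ∀ i K → r M K ≤ r M (⁅ i ⁆ ∪ K)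
  r-insert-mono i K = r-mono M (q⊆p∪q ⁅ i ⁆ K)

  r-insert-≤ : ∀ i K → r M (⁅ i ⁆ ∪ K) ≤ suc (r M K)
  r-insert-≤ i K = begin
    r M (⁅ i ⁆ ∪ K)                        ≤⟨ m≤m+n _ _ ⟩
    r M (⁅ i ⁆ ∪ K) + r M (⁅ i ⁆ ∩ K)      ≤⟨ r-sub M ⁅ i ⁆ K ⟩
    r M ⁅ i ⁆ + r M K                      ≤⟨ +-monoˡ-≤ (r M K) (r-bound M ⁅ i ⁆) ⟩
    ∣ ⁅ i ⁆ ∣ + r M K                      ≡⟨ cong (_+ r M K) (∣⁅x⁆∣≡1 i) ⟩
    suc (r M K)                            ∎
    where open ≤-Reasoning

  ¬spans⇒r-insert : ∀ {K i} → ¬ Spans K i → r M (⁅ i ⁆ ∪ K) ≡ suc (r M K)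
  ¬spans⇒r-insert {K} {i} ¬spans =
    ≤-antisym (r-insert-≤ i K) (≤∧≢⇒< (r-insert-mono i K) (≢-sym ¬spans))

  r-insert-submodular : ∀ i {A B} → A ⊆ B → r M (⁅ i ⁆ ∪ B) + r M A ≤ r M (⁅ i ⁆ ∪ A) + r M B
  r-insert-submodular i {A} {B} A⊆B =
    ≤-trans (+-mono-≤ (r-mono M iB⊆) (r-mono M A⊆)) (r-sub M (⁅ i ⁆ ∪ A) B)
    where
    iB⊆ : ⁅ i ⁆ ∪ B ⊆ (⁅ i ⁆ ∪ A) ∪ B
    iB⊆ h = [ (λ h′ → p⊆p∪q B (p⊆p∪q A h′)) , q⊆p∪q _ B ] (x∈p∪q⁻ ⁅ i ⁆ B h)
    A⊆ : A ⊆ (⁅ i ⁆ ∪ A) ∩ B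
    A⊆ h = x∈p∩q⁺ (q⊆p∪q ⁅ i ⁆ A h , A⊆B h)

  spans-mono : ∀ {A B i} → A ⊆ B → Spans A i → Spans B i
  spans-mono {A} {B} {i} A⊆B spans = ≤-antisym
    (+-cancelʳ-≤ (r M A) _ _ (begin
      r M (⁅ i ⁆ ∪ B) + r M A  ≤⟨ r-insert-submodular i A⊆B ⟩
      r M (⁅ i ⁆ ∪ A) + r M B  ≡⟨ cong (_+ r M B) spans ⟩
      r M A + r M B            ≡⟨ +-comm (r M A) (r M B) ⟩
      r M B + r M A            ∎))
    (r-insert-mono i B)
    where open ≤-Reasoning

  InCI⇒spans-reflected : ∀ {i j K} → InCI M i j K → Spans (⁅ j ⁆ ∪ K) i → Spans K i
  InCI⇒spans-reflected {i} {j} {K} ci spans = +-cancelʳ-≡ (r M (⁅ j ⁆ ∪ K)) _ _ (begin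
    r M (⁅ i ⁆ ∪ K) + r M (⁅ j ⁆ ∪ K)          ≡⟨ ci ⟩
    r M (⁅ i ⁆ ∪ ⁅ j ⁆ ∪ K) + r M K            ≡⟨ cong (_+ r M K) spans ⟩
    r M (⁅ j ⁆ ∪ K) + r M K                    ≡⟨ +-comm (r M (⁅ j ⁆ ∪ K)) (r M K) ⟩
    r M K + r M (⁅ j ⁆ ∪ K)                    ∎)
    where open ≡-Reasoning

  spans-reflected⇒InCI : ∀ {i j K} → (Spans (⁅ j ⁆ ∪ K) i → Spans K i) → InCI M i j K
  spans-reflected⇒InCI {i} {j} {K} reflect with spans? K i
  ... | yes spans = begin
    r M (⁅ i ⁆ ∪ K) + r M (⁅ j ⁆ ∪ K)  ≡⟨ cong (_+ r M (⁅ j ⁆ ∪ K)) spans ⟩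
    r M K + r M (⁅ j ⁆ ∪ K)            ≡⟨ +-comm (r M K) _ ⟩
    r M (⁅ j ⁆ ∪ K) + r M K            ≡⟨ cong (_+ r M K) (spans-mono (q⊆p∪q ⁅ j ⁆ K) spans) ⟨
    r M (⁅ i ⁆ ∪ ⁅ j ⁆ ∪ K) + r M K    ∎
    where open ≡-Reasoning
  ... | no ¬spans = begin
    r M (⁅ i ⁆ ∪ K) + r M (⁅ j ⁆ ∪ K)  ≡⟨ cong (_+ r M (⁅ j ⁆ ∪ K)) (¬spans⇒r-insert ¬spans) ⟩
    suc (r M K + r M (⁅ j ⁆ ∪ K))      ≡⟨ cong suc (+-comm (r M K) _) ⟩
    suc (r M (⁅ j ⁆ ∪ K)) + r M K      ≡⟨ cong (_+ r M K) (¬spans⇒r-insert (¬spans ∘ reflect)) ⟨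
    r M (⁅ i ⁆ ∪ ⁅ j ⁆ ∪ K) + r M K    ∎
    where open ≡-Reasoning

  ¬InCI⇒spans : ∀ {i j K} → ¬ InCI M i j K → Spans (⁅ j ⁆ ∪ K) i
  ¬InCI⇒spans {i} {j} {K} ¬ci with spans? (⁅ j ⁆ ∪ K) i
  ... | yes spans = spans
  ... | no ¬spans = ⊥-elim (¬ci (spans-reflected⇒InCI (⊥-elim ∘ ¬spans)))

module _ {n : ℕ} {G : Family n} {M : Matroid n} (G≡[[M]] : Represents G M) where

  represents⇒MCI : MCI G
  represents⇒MCI i j l K L (i≢j , i≢l , j≢l) (i∉K , j∉K , l∉K) (i∉L , j∉L , l∉L) _ ij∉G =
    proj₂ (G≡[[M]] i l S (i≢l , i∉S , l∉S))
      (spans-reflected⇒InCI M λ _ → spans-mono M jK⊆S (¬InCI⇒spans M ¬ci))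
    where
    S = ⁅ j ⁆ ∪ K ∪ L
    i∉S = x∉⁅y⁆∪p⁺ i≢j (x∉p∪q⁺ i∉K i∉L)
    l∉S = x∉⁅y⁆∪p⁺ (≢-sym j≢l) (x∉p∪q⁺ l∉K l∉L)
    jK⊆S : ⁅ j ⁆ ∪ K ⊆ S
    jK⊆S = ∪-monoʳ-⊆ ⁅ j ⁆ (p⊆p∪q L)
    ¬ci : ¬ InCI M i j K
    ¬ci ci = true≢false (trans (sym (proj₂ (G≡[[M]] i j K (i≢j , i∉K , j∉K)) ci)) ij∉G)

  represents⇒SG : SG G
  represents⇒SG i j l K (i≢j , i≢l , j≢l) (i∉K , j∉K , l∉K) ij∈G il∈G =
    proj₂ (G≡[[M]] i l K (i≢l , i∉K , l∉K))
      (spans-reflected⇒InCI M (reflect-j ∘ reflect-l ∘ spans-mono M lK⊆ljK)) ,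
    proj₂ (G≡[[M]] i j (⁅ l ⁆ ∪ K) (i≢j , x∉⁅y⁆∪p⁺ i≢l i∉K , x∉⁅y⁆∪p⁺ j≢l j∉K))
      (spans-reflected⇒InCI M
        (spans-mono M (q⊆p∪q ⁅ l ⁆ K) ∘ reflect-j ∘ reflect-l ∘ subst (λ Z → Spans M Z i) (∪-swap ⁅ j ⁆ ⁅ l ⁆ K)))
    where
    reflect-j = InCI⇒spans-reflected M (proj₁ (G≡[[M]] i j K (i≢j , i∉K , j∉K)) ij∈G)
    reflect-l = InCI⇒spans-reflected M
      (proj₁ (G≡[[M]] i l (⁅ j ⁆ ∪ K) (i≢l , x∉⁅y⁆∪p⁺ i≢j i∉K , x∉⁅y⁆∪p⁺ (≢-sym j≢l) l∉K)) il∈G)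
    lK⊆ljK : ⁅ l ⁆ ∪ K ⊆ ⁅ l ⁆ ∪ ⁅ j ⁆ ∪ K
    lK⊆ljK = ∪-monoʳ-⊆ ⁅ l ⁆ (q⊆p∪q ⁅ j ⁆ K)

module _ {n : ℕ} (M M′ : Matroid n) (loopless : Loopless M) (loopless′ : Loopless M′)
  (same-CI : ∀ i j K → Valid i j K → (InCI M i j K → InCI M′ i j K) × (InCI M′ i j K → InCI M i j K))
  where

  private
    AgreeAround : Subset n → Set
    AgreeAround K = r M K ≡ r M′ K × (∀ i → i ∉ K → r M (⁅ i ⁆ ∪ K) ≡ r M′ (⁅ i ⁆ ∪ K))

    agree-⊥ : AgreeAround ⊥
    agree-⊥ = trans (r-⊥ M) (sym (r-⊥ M′)) , λ i _ → begin
      r M (⁅ i ⁆ ∪ ⊥)  ≡⟨ cong (r M) (∪-identityʳ ⁅ i ⁆) ⟩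
      r M ⁅ i ⁆        ≡⟨ trans (r-⁅x⁆≡1 M loopless i) (sym (r-⁅x⁆≡1 M′ loopless′ i)) ⟩
      r M′ ⁅ i ⁆       ≡⟨ cong (r M′) (∪-identityʳ ⁅ i ⁆) ⟨
      r M′ (⁅ i ⁆ ∪ ⊥) ∎
      where open ≡-Reasoning

    agree-insert : ∀ {x K} → x ∉ K → AgreeAround K → AgreeAround (⁅ x ⁆ ∪ K)
    agree-insert {x} {K} x∉K (agree , agree₁) = agree₁ x x∉K , agree₁′
      where
      agree₁′ : ∀ i → i ∉ ⁅ x ⁆ ∪ K → r M (⁅ i ⁆ ∪ ⁅ x ⁆ ∪ K) ≡ r M′ (⁅ i ⁆ ∪ ⁅ x ⁆ ∪ K)
      agree₁′ i i∉xK = by-cases (same-CI i x K (i≢x , i∉K , x∉K))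
        (r M (⁅ i ⁆ ∪ K) + r M (⁅ x ⁆ ∪ K) ≟ r M (⁅ i ⁆ ∪ ⁅ x ⁆ ∪ K) + r M K)
        where
        open ≡-Reasoning
        i∉K : i ∉ K
        i∉K = i∉xK ∘ q⊆p∪q ⁅ x ⁆ K
        i≢x : i ≢ x
        i≢x i≡x = i∉xK (subst (_∈ ⁅ x ⁆ ∪ K) (sym i≡x) (x∈⁅x⁆∪p x K))
        by-cases : (InCI M i x K → InCI M′ i x K) × (InCI M′ i x K → InCI M i x K) →
          Dec (InCI M i x K) → r M (⁅ i ⁆ ∪ ⁅ x ⁆ ∪ K) ≡ r M′ (⁅ i ⁆ ∪ ⁅ x ⁆ ∪ K)
        by-cases (to , _) (yes ci) = +-cancelʳ-≡ (r M K) _ _ (begin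
          r M (⁅ i ⁆ ∪ ⁅ x ⁆ ∪ K) + r M K     ≡⟨ ci ⟨
          r M (⁅ i ⁆ ∪ K) + r M (⁅ x ⁆ ∪ K)   ≡⟨ cong₂ _+_ (agree₁ i i∉K) (agree₁ x x∉K) ⟩
          r M′ (⁅ i ⁆ ∪ K) + r M′ (⁅ x ⁆ ∪ K) ≡⟨ to ci ⟩
          r M′ (⁅ i ⁆ ∪ ⁅ x ⁆ ∪ K) + r M′ K   ≡⟨ cong (r M′ (⁅ i ⁆ ∪ ⁅ x ⁆ ∪ K) +_) agree ⟨
          r M′ (⁅ i ⁆ ∪ ⁅ x ⁆ ∪ K) + r M K    ∎)
        by-cases (_ , from) (no ¬ci) = begin
          r M (⁅ i ⁆ ∪ ⁅ x ⁆ ∪ K)   ≡⟨ ¬InCI⇒spans M ¬ci ⟩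
          r M (⁅ x ⁆ ∪ K)           ≡⟨ agree₁ x x∉K ⟩
          r M′ (⁅ x ⁆ ∪ K)          ≡⟨ ¬InCI⇒spans M′ (¬ci ∘ from) ⟨
          r M′ (⁅ i ⁆ ∪ ⁅ x ⁆ ∪ K)  ∎

  rank-unique : ∀ X → r M X ≡ r M′ X
  rank-unique X = proj₁ (⊆-induction AgreeAround (⊥⊆ {p = X}) agree-⊥
    (λ _ _ _ x∉S → agree-insert x∉S))

module RankFromIncrements {n : ℕ} (δ : Fin n → Subset n → ℕ)
  (δ-exchange : ∀ {i j K} → i ≢ j → i ∉ K → j ∉ K →
    δ j K + δ i (⁅ j ⁆ ∪ K) ≡ δ i K + δ j (⁅ i ⁆ ∪ K))
  where

  -- Elements of X are added in the reverse order of xs; the exchange law makes the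
  -- result independent of that order (rankAlong-insert).
  rankAlong : List (Fin n) → Subset n → ℕ
  rankAlong []       X = 0
  rankAlong (x ∷ xs) X with x ∈? X
  ... | yes _ = rankAlong xs (X - x) + δ x (X - x)
  ... | no  _ = rankAlong xs X

  rankAlong-∈ : ∀ {x X} xs → x ∈ X → rankAlong (x ∷ xs) X ≡ rankAlong xs (X - x) + δ x (X - x)
  rankAlong-∈ {x} {X} xs x∈X with x ∈? X
  ... | yes _   = refl
  ... | no  x∉X = ⊥-elim (x∉X x∈X)

  rankAlong-∉ : ∀ {x X} xs → x ∉ X → rankAlong (x ∷ xs) X ≡ rankAlong xs X
  rankAlong-∉ {x} {X} xs x∉X with x ∈? X
  ... | yes x∈X = ⊥-elim (x∉X x∈X)
  ... | no  _   = refl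

  Covers : List (Fin n) → Subset n → Set
  Covers xs X = ∀ {y} → y ∈ X → y ∈ₗ xs

  covers-∷⁻ : ∀ {x xs X Y} → Covers (x ∷ xs) X → Y ⊆ X → x ∉ Y → Covers xs Y
  covers-∷⁻ {Y = Y} covers Y⊆X x∉Y {y} y∈Y with covers (Y⊆X y∈Y)
  ... | here refl = ⊥-elim (x∉Y y∈Y)
  ... | there y∈xs = y∈xs

  rankAlong-insert : ∀ xs {i K} → Covers xs (⁅ i ⁆ ∪ K) → i ∉ K →
    rankAlong xs (⁅ i ⁆ ∪ K) ≡ rankAlong xs K + δ i K
  rankAlong-insert [] {i} {K} covers _ with covers (x∈⁅x⁆∪p i K)
  ... | ()
  rankAlong-insert (x ∷ xs) {i} {K} covers i∉K with x ≟ᶠ i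
  ... | yes refl = begin
    rankAlong (x ∷ xs) (⁅ x ⁆ ∪ K)                        ≡⟨ rankAlong-∈ xs (x∈⁅x⁆∪p x K) ⟩
    rankAlong xs ((⁅ x ⁆ ∪ K) - x) + δ x ((⁅ x ⁆ ∪ K) - x) ≡⟨ cong (λ Z → rankAlong xs Z + δ x Z) (x∉p⇒[⁅x⁆∪p]-x≡p i∉K) ⟩
    rankAlong xs K + δ x K                                ≡⟨ cong (_+ δ x K) (rankAlong-∉ xs i∉K) ⟨
    rankAlong (x ∷ xs) K + δ x K                          ∎
    where open ≡-Reasoning
  ... | no x≢i = by-membership (x ∈? K)
    where
    open ≡-Reasoning
    by-membership : Dec (x ∈ K) → rankAlong (x ∷ xs) (⁅ i ⁆ ∪ K) ≡ rankAlong (x ∷ xs) K + δ i K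
    by-membership (no x∉K) = begin
      rankAlong (x ∷ xs) (⁅ i ⁆ ∪ K)  ≡⟨ rankAlong-∉ xs x∉iK ⟩
      rankAlong xs (⁅ i ⁆ ∪ K)        ≡⟨ rankAlong-insert xs (covers-∷⁻ covers ⊆-refl x∉iK) i∉K ⟩
      rankAlong xs K + δ i K          ≡⟨ cong (_+ δ i K) (rankAlong-∉ xs x∉K) ⟨
      rankAlong (x ∷ xs) K + δ i K    ∎
      where
      x∉iK = x∉⁅y⁆∪p⁺ x≢i x∉K
    by-membership (yes x∈K) = begin
      rankAlong (x ∷ xs) (⁅ i ⁆ ∪ K)                          ≡⟨ rankAlong-∈ xs (q⊆p∪q ⁅ i ⁆ K x∈K) ⟩
      rankAlong xs ((⁅ i ⁆ ∪ K) - x) + δ x ((⁅ i ⁆ ∪ K) - x)   ≡⟨ cong (λ Z → rankAlong xs Z + δ x Z) (x≢y⇒[⁅y⁆∪p]-x≡⁅y⁆∪[p-x] x≢i) ⟩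
      rankAlong xs (⁅ i ⁆ ∪ K′) + δ x (⁅ i ⁆ ∪ K′)             ≡⟨ cong (_+ δ x (⁅ i ⁆ ∪ K′)) (rankAlong-insert xs covers′ i∉K′) ⟩
      rankAlong xs K′ + δ i K′ + δ x (⁅ i ⁆ ∪ K′)              ≡⟨ +-assoc (rankAlong xs K′) _ _ ⟩
      rankAlong xs K′ + (δ i K′ + δ x (⁅ i ⁆ ∪ K′))            ≡⟨ cong (rankAlong xs K′ +_) (δ-exchange (≢-sym x≢i) i∉K′ x∉p-x) ⟨
      rankAlong xs K′ + (δ x K′ + δ i (⁅ x ⁆ ∪ K′))            ≡⟨ +-assoc (rankAlong xs K′) _ _ ⟨
      rankAlong xs K′ + δ x K′ + δ i (⁅ x ⁆ ∪ K′)              ≡⟨ cong₂ _+_ (rankAlong-∈ xs x∈K) (cong (δ i) (sym (x∈p⇒⁅x⁆∪[p-x]≡p x∈K))) ⟨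
      rankAlong (x ∷ xs) K + δ i K                            ∎
      where
      K′ = K - x
      i∉K′ : i ∉ K′
      i∉K′ = i∉K ∘ p─q⊆p K ⁅ x ⁆
      covers′ : Covers xs (⁅ i ⁆ ∪ K′)
      covers′ = covers-∷⁻ covers (∪-monoʳ-⊆ ⁅ i ⁆ (p─q⊆p K ⁅ x ⁆)) (x∉⁅y⁆∪p⁺ x≢i x∉p-x)

  rank : Subset n → ℕ
  rank = rankAlong (allFin n)

  rank-insert : ∀ {i K} → i ∉ K → rank (⁅ i ⁆ ∪ K) ≡ rank K + δ i K
  rank-insert = rankAlong-insert (allFin n) (λ {y} _ → ∈-allFin y)

  rank-⊥ : rank ⊥ ≡ 0
  rank-⊥ = go (allFin n)
    where
    go : ∀ xs → rankAlong xs ⊥ ≡ 0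
    go []       = refl
    go (x ∷ xs) = trans (rankAlong-∉ {x} xs ∉⊥) (go xs)

  rank-insert-mono : ∀ {l S} → l ∉ S → rank S ≤ rank (⁅ l ⁆ ∪ S)
  rank-insert-mono {l} {S} l∉S = subst (rank S ≤_) (sym (rank-insert l∉S)) (m≤m+n (rank S) _)

  rank-mono : ∀ {X Y} → X ⊆ Y → rank X ≤ rank Y
  rank-mono {X} X⊆Y = ⊆-induction (λ S → rank X ≤ rank S) X⊆Y ≤-refl
    (λ _ _ _ l∉S X≤S → ≤-trans X≤S (rank-insert-mono l∉S))

  module _ (δ≤1 : ∀ i K → δ i K ≤ 1) where

    rank-bound : ∀ X → rank X ≤ ∣ X ∣
    rank-bound X = ⊆-induction (λ S → rank S ≤ ∣ S ∣) (⊥⊆ {p = X})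
      (≤-reflexive (trans rank-⊥ (sym (∣⊥∣≡0 n)))) step
      where
      step : ∀ {l S} → ⊥ ⊆ S → S ⊆ X → l ∈ X → l ∉ S → rank S ≤ ∣ S ∣ → rank (⁅ l ⁆ ∪ S) ≤ ∣ ⁅ l ⁆ ∪ S ∣
      step {l} {S} _ _ _ l∉S ih = begin
        rank (⁅ l ⁆ ∪ S)  ≡⟨ rank-insert l∉S ⟩
        rank S + δ l S    ≤⟨ +-mono-≤ ih (δ≤1 l S) ⟩
        ∣ S ∣ + 1         ≡⟨ +-comm ∣ S ∣ 1 ⟩
        suc ∣ S ∣         ≤⟨ p⊂q⇒∣p∣<∣q∣ (q⊆p∪q ⁅ l ⁆ S , l , x∈⁅x⁆∪p l S , l∉S) ⟩
        ∣ ⁅ l ⁆ ∪ S ∣     ∎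
        where open ≤-Reasoning

  module _ (δ-antitone : ∀ {i S T} → S ⊆ T → δ i T ≤ δ i S) where

    -- Grow Y from X ∩ Y; each new l ∈ Y lies outside X ∪ S, so the increment it adds
    -- to X ∪ S is at most the one it adds to S.
    rank-submodular : ∀ X Y → rank (X ∪ Y) + rank (X ∩ Y) ≤ rank X + rank Y
    rank-submodular X Y = ⊆-induction (λ S → rank (X ∪ S) + rank (X ∩ Y) ≤ rank X + rank S)
      (p∩q⊆q X Y) (≤-reflexive (cong (λ Z → rank Z + rank (X ∩ Y)) (∪-abs-∩ X Y))) step
      where
      step : ∀ {l S} → X ∩ Y ⊆ S → S ⊆ Y → l ∈ Y → l ∉ S →
        rank (X ∪ S) + rank (X ∩ Y) ≤ rank X + rank S →
        rank (X ∪ ⁅ l ⁆ ∪ S) + rank (X ∩ Y) ≤ rank X + rank (⁅ l ⁆ ∪ S)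
      step {l} {S} X∩Y⊆S _ l∈Y l∉S ih = begin
        rank (X ∪ ⁅ l ⁆ ∪ S) + rank (X ∩ Y)              ≡⟨ cong (λ Z → rank Z + rank (X ∩ Y)) (∪-swap X ⁅ l ⁆ S) ⟩
        rank (⁅ l ⁆ ∪ X ∪ S) + rank (X ∩ Y)              ≡⟨ cong (_+ rank (X ∩ Y)) (rank-insert l∉X∪S) ⟩
        rank (X ∪ S) + δ l (X ∪ S) + rank (X ∩ Y)        ≡⟨ xy∙z≈xz∙y (rank (X ∪ S)) _ _ ⟩
        rank (X ∪ S) + rank (X ∩ Y) + δ l (X ∪ S)        ≤⟨ +-mono-≤ ih (δ-antitone (q⊆p∪q X S)) ⟩
        rank X + rank S + δ l S                          ≡⟨ +-assoc (rank X) _ _ ⟩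
        rank X + (rank S + δ l S)                        ≡⟨ cong (rank X +_) (rank-insert l∉S) ⟨
        rank X + rank (⁅ l ⁆ ∪ S)                        ∎
        where
        open ≤-Reasoning
        l∉X∪S : l ∉ X ∪ S
        l∉X∪S = x∉p∪q⁺ (λ l∈X → l∉S (X∩Y⊆S (x∈p∩q⁺ (l∈X , l∈Y)))) l∉S

  matroid : (∀ i K → δ i K ≤ 1) → (∀ {i S T} → S ⊆ T → δ i T ≤ δ i S) → Matroid n
  matroid δ≤1 δ-antitone = record
    { r       = rank
    ; r-bound = rank-bound δ≤1
    ; r-mono  = rank-mono
    ; r-sub   = rank-submodular δ-antitone
    }

module FromFamily {n : ℕ} (G : Family n) (G-sym : SymFamily G) (G-mci : MCI G) (G-sg : SG G) where

  -- Depends i K will be i ∈ cl(K) in the matroid built from G.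
  Depends : Fin n → Subset n → Set
  Depends i K = Σ (Fin n) λ j → Σ (Subset n) λ K′ → j ∈ K × K′ ⊆ K × j ∉ K′ × G i j K′ ≡ false

  depends? : ∀ i K → Dec (Depends i K)
  depends? i K = any? λ j → anySubset? λ K′ →
    j ∈? K ×-dec K′ ⊆? K ×-dec ¬? (j ∈? K′) ×-dec G i j K′ Bool.≟ false

  depends-mono : ∀ {i K L} → K ⊆ L → Depends i K → Depends i L
  depends-mono K⊆L (j , K′ , j∈K , K′⊆K , j∉K′ , ∉G) = j , K′ , K⊆L j∈K , K⊆L ∘ K′⊆K , j∉K′ , ∉G

  ¬depends⇒∈G : ∀ {i j K K′} → ¬ Depends i K → j ∈ K → K′ ⊆ K → j ∉ K′ → G i j K′ ≡ true
  ¬depends⇒∈G {i} {j} {K} {K′} ¬dep j∈K K′⊆K j∉K′ with G i j K′ in ∉G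
  ... | true  = refl
  ... | false = ⊥-elim (¬dep (j , K′ , j∈K , K′⊆K , j∉K′ , ∉G))

  -- (MCI) with L = K ∖ jK′ puts (ij|K) into G.
  ∉G⇒¬depends : ∀ {i j K} → i ≢ j → i ∉ K → j ∉ K → G i j K ≡ false → ¬ Depends i K
  ∉G⇒¬depends {i} {j} {K} i≢j i∉K j∉K ij∉G (j′ , K′ , j′∈K , K′⊆K , j′∉K′ , ij′∉G) =
    true≢false (trans (sym ij∈G) ij∉G)
    where
    L = K ─ (⁅ j′ ⁆ ∪ K′)
    L⊆K : L ⊆ K
    L⊆K = p─q⊆p K _
    j′K′∩L : ∀ {x} → x ∈ ⁅ j′ ⁆ ∪ K′ → x ∉ L
    j′K′∩L x∈ x∈L = x∈p─q⇒x∉q K _ x∈L x∈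
    j′K′L≡K : ⁅ j′ ⁆ ∪ K′ ∪ L ≡ K
    j′K′L≡K = trans (sym (∪-assoc ⁅ j′ ⁆ K′ L))
      (p⊆q⇒p∪[q─p]≡q (⁅x⁆∪p⊆q j′∈K K′⊆K))
    ij∈G : G i j K ≡ true
    ij∈G = subst (λ Z → G i j Z ≡ true) j′K′L≡K
      (G-mci i j′ j K′ L
        (≢-sym (x∈p∧y∉p⇒x≢y j′∈K i∉K) , i≢j , x∈p∧y∉p⇒x≢y j′∈K j∉K)
        (i∉K ∘ K′⊆K , j′∉K′ , j∉K ∘ K′⊆K)
        (i∉K ∘ L⊆K , j′K′∩L (x∈⁅x⁆∪p j′ K′) , j∉K ∘ L⊆K)
        (λ x x∈K′ → j′K′∩L (q⊆p∪q ⁅ j′ ⁆ K′ x∈K′))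
        ij′∉G)

  -- (SG) carries (ij|S) ∉ G to (ij|lS) ∉ G, since (il|S) ∈ G for i independent of K ⊇ lS.
  ∉G-upward : ∀ {i j K′ K} → i ≢ j → i ∉ K → j ∉ K → K′ ⊆ K → ¬ Depends i K →
    G i j K′ ≡ false → G i j K ≡ false
  ∉G-upward {i} {j} {K′} {K} i≢j i∉K j∉K K′⊆K ¬dep ij∉G =
    ⊆-induction (λ S → G i j S ≡ false) K′⊆K ij∉G step
    where
    step : ∀ {l S} → K′ ⊆ S → S ⊆ K → l ∈ K → l ∉ S → G i j S ≡ false → G i j (⁅ l ⁆ ∪ S) ≡ false
    step {l} {S} _ S⊆K l∈K l∉S ij∉G[S] with G i j (⁅ l ⁆ ∪ S) in ij[lS]
    ... | false = refl
    ... | true  = ⊥-elim (true≢false (trans (sym ij∈G[S]) ij∉G[S]))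
      where
      ij∈G[S] = proj₁ (G-sg i l j S
        (≢-sym (x∈p∧y∉p⇒x≢y l∈K i∉K) , i≢j , x∈p∧y∉p⇒x≢y l∈K j∉K)
        (i∉K ∘ S⊆K , l∉S , j∉K ∘ S⊆K)
        (¬depends⇒∈G ¬dep l∈K S⊆K l∉S) ij[lS])

  ¬depends∧depends-insert⇒∉G : ∀ {i j K} → i ≢ j → i ∉ K → j ∉ K →
    ¬ Depends i K → Depends i (⁅ j ⁆ ∪ K) → G i j K ≡ false
  ¬depends∧depends-insert⇒∉G {i} {j} {K} i≢j i∉K j∉K ¬dep (j′ , K′ , j′∈jK , K′⊆jK , j′∉K′ , ij′∉G)
    with j′ ≟ᶠ j
  ... | yes refl = ∉G-upward i≢j i∉K j∉K (p⊆⁅x⁆∪q∧x∉p⇒p⊆q K′⊆jK j′∉K′) ¬dep ij′∉G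
  ... | no j′≢j with j ∈? K′
  ...   | no j∉K′  = ⊥-elim (¬dep (j′ , K′ , x∈⁅y⁆∪p∧x≢y⇒x∈p j′∈jK j′≢j ,
                                  p⊆⁅x⁆∪q∧x∉p⇒p⊆q K′⊆jK j∉K′ , j′∉K′ , ij′∉G))
  ...   | yes j∈K′ = ∉G-upward i≢j i∉K j∉K j′K″⊆K ¬dep ij∉G[j′K″]
    where
    -- With K′ = jK″, (SG) applied to (ij′|K″) ∈ G forces (ij|j′K″) ∉ G, as (ij′|K′) ∉ G.
    j′∈K = x∈⁅y⁆∪p∧x≢y⇒x∈p j′∈jK j′≢j
    K″ = K′ - j
    K″⊆K : K″ ⊆ K
    K″⊆K = p⊆⁅x⁆∪q∧x∉p⇒p⊆q (K′⊆jK ∘ p─q⊆p K′ ⁅ j ⁆) x∉p-x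
    j′K″⊆K : ⁅ j′ ⁆ ∪ K″ ⊆ K
    j′K″⊆K = ⁅x⁆∪p⊆q j′∈K K″⊆K
    ij∉G[j′K″] : G i j (⁅ j′ ⁆ ∪ K″) ≡ false
    ij∉G[j′K″] with G i j (⁅ j′ ⁆ ∪ K″) in ij[j′K″]
    ... | false = refl
    ... | true  = ⊥-elim (true≢false (trans (sym ij′∈G[K′]) ij′∉G))
      where
      ij′∈G[K′] = subst (λ Z → G i j′ Z ≡ true) (x∈p⇒⁅x⁆∪[p-x]≡p j∈K′)
        (proj₂ (G-sg i j′ j K″
          (≢-sym (x∈p∧y∉p⇒x≢y j′∈K i∉K) , i≢j , j′≢j)
          (i∉K ∘ K″⊆K , j′∉K′ ∘ p─q⊆p K′ ⁅ j ⁆ , x∉p-x)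
          (¬depends⇒∈G ¬dep j′∈K K″⊆K (j′∉K′ ∘ p─q⊆p K′ ⁅ j ⁆)) ij[j′K″]))

  depends-transfer : ∀ {i j K} → i ≢ j → i ∉ K → j ∉ K →
    Depends i K → Depends j (⁅ i ⁆ ∪ K) → Depends j K
  depends-transfer {i} {j} {K} i≢j i∉K j∉K dep-i dep-j with depends? j K
  ... | yes dep = dep
  ... | no ¬dep = ⊥-elim (∉G⇒¬depends i≢j i∉K j∉K
        (trans (G-sym i j K (i≢j , i∉K , j∉K)) (¬depends∧depends-insert⇒∉G (≢-sym i≢j) j∉K i∉K ¬dep dep-j))
        dep-i)

  depends-exchange : ∀ {i j K} → i ≢ j → i ∉ K → j ∉ K →
    ¬ Depends i K → Depends i (⁅ j ⁆ ∪ K) → Depends j (⁅ i ⁆ ∪ K)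
  depends-exchange {i} {j} {K} i≢j i∉K j∉K ¬dep dep =
    i , K , x∈⁅x⁆∪p i K , q⊆p∪q ⁅ i ⁆ K , i∉K ,
    trans (G-sym j i K (≢-sym i≢j , j∉K , i∉K)) (¬depends∧depends-insert⇒∉G i≢j i∉K j∉K ¬dep dep)

  increment : Fin n → Subset n → ℕ
  increment i K with depends? i K
  ... | yes _ = 0
  ... | no  _ = 1

  increment-depends : ∀ {i K} → Depends i K → increment i K ≡ 0
  increment-depends {i} {K} dep with depends? i K
  ... | yes _   = refl
  ... | no ¬dep = ⊥-elim (¬dep dep)

  increment-¬depends : ∀ {i K} → ¬ Depends i K → increment i K ≡ 1
  increment-¬depends {i} {K} ¬dep with depends? i K
  ... | yes dep = ⊥-elim (¬dep dep)
  ... | no  _   = refl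

  increment≤1 : ∀ i K → increment i K ≤ 1
  increment≤1 i K with depends? i K
  ... | yes _ = z≤n
  ... | no  _ = s≤s z≤n

  increment-antitone : ∀ {i S T} → S ⊆ T → increment i T ≤ increment i S
  increment-antitone {i} {S} {T} S⊆T with depends? i S
  ... | yes dep = ≤-reflexive (increment-depends (depends-mono S⊆T dep))
  ... | no  _   = increment≤1 i T

  increment-exchange : ∀ {i j K} → i ≢ j → i ∉ K → j ∉ K →
    increment j K + increment i (⁅ j ⁆ ∪ K) ≡ increment i K + increment j (⁅ i ⁆ ∪ K)
  increment-exchange {i} {j} {K} i≢j i∉K j∉K with depends? i K | depends? j K
  ... | yes dep-i | yes dep-j
    rewrite increment-depends (depends-mono (q⊆p∪q ⁅ j ⁆ K) dep-i)
          | increment-depends (depends-mono (q⊆p∪q ⁅ i ⁆ K) dep-j) = refl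
  ... | yes dep-i | no ¬dep-j
    rewrite increment-depends (depends-mono (q⊆p∪q ⁅ j ⁆ K) dep-i)
          | increment-¬depends (¬dep-j ∘ depends-transfer i≢j i∉K j∉K dep-i) = refl
  ... | no ¬dep-i | yes dep-j
    rewrite increment-depends (depends-mono (q⊆p∪q ⁅ i ⁆ K) dep-j)
          | increment-¬depends (¬dep-i ∘ depends-transfer (≢-sym i≢j) j∉K i∉K dep-j) = refl
  ... | no ¬dep-i | no ¬dep-j = cong suc (both-or-neither (depends? i (⁅ j ⁆ ∪ K)))
    where
    both-or-neither : Dec (Depends i (⁅ j ⁆ ∪ K)) → increment i (⁅ j ⁆ ∪ K) ≡ increment j (⁅ i ⁆ ∪ K)
    both-or-neither (yes dep-ij) =
      trans (increment-depends dep-ij) (sym (increment-depends (depends-exchange i≢j i∉K j∉K ¬dep-i dep-ij)))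
    both-or-neither (no ¬dep-ij) =
      trans (increment-¬depends ¬dep-ij)
        (sym (increment-¬depends (¬dep-ij ∘ depends-exchange (≢-sym i≢j) j∉K i∉K ¬dep-j)))

  open RankFromIncrements increment increment-exchange

  M : Matroid n
  M = matroid increment≤1 increment-antitone

  spans⇒depends : ∀ {i K} → i ∉ K → Spans M K i → Depends i K
  spans⇒depends {i} {K} i∉K spans with depends? i K
  ... | yes dep = dep
  ... | no ¬dep = ⊥-elim (1+n≢n (begin
    suc (rank K)             ≡⟨ +-comm 1 (rank K) ⟩
    rank K + 1               ≡⟨ cong (rank K +_) (increment-¬depends ¬dep) ⟨
    rank K + increment i K   ≡⟨ rank-insert i∉K ⟨
    rank (⁅ i ⁆ ∪ K)         ≡⟨ spans ⟩
    rank K                   ∎))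
    where open ≡-Reasoning

  depends⇒spans : ∀ {i K} → i ∉ K → Depends i K → Spans M K i
  depends⇒spans {i} {K} i∉K dep =
    trans (rank-insert i∉K) (trans (cong (rank K +_) (increment-depends dep)) (+-identityʳ (rank K)))

  M-loopless : Loopless M
  M-loopless e rank≡0 = 1+n≢n (begin
    1                        ≡⟨ increment-¬depends (λ (_ , _ , j∈⊥ , _) → ∉⊥ j∈⊥) ⟨
    increment e ⊥            ≡⟨ cong (_+ increment e ⊥) rank-⊥ ⟨
    rank ⊥ + increment e ⊥   ≡⟨ rank-insert ∉⊥ ⟨
    rank (⁅ e ⁆ ∪ ⊥)         ≡⟨ cong rank (∪-identityʳ ⁅ e ⁆) ⟩
    rank ⁅ e ⁆               ≡⟨ rank≡0 ⟩
    0                        ∎)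
    where open ≡-Reasoning

  G≡[[M]] : Represents G M
  G≡[[M]] i j K (i≢j , i∉K , j∉K) = ∈G⇒InCI , InCI⇒∈G
    where
    i∉jK = x∉⁅y⁆∪p⁺ i≢j i∉K
    ∈G⇒InCI : G i j K ≡ true → InCI M i j K
    ∈G⇒InCI ij∈G = spans-reflected⇒InCI M λ spans → depends⇒spans i∉K (by-cases (depends? i K)
      (spans⇒depends i∉jK spans))
      where
      by-cases : Dec (Depends i K) → Depends i (⁅ j ⁆ ∪ K) → Depends i K
      by-cases (yes dep) _ = dep
      by-cases (no ¬dep) dep-jK = ⊥-elim (true≢false
        (trans (sym ij∈G) (¬depends∧depends-insert⇒∉G i≢j i∉K j∉K ¬dep dep-jK)))
    InCI⇒∈G : InCI M i j K → G i j K ≡ true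
    InCI⇒∈G ci with G i j K in ij∉G
    ... | true  = refl
    ... | false = ⊥-elim (∉G⇒¬depends i≢j i∉K j∉K ij∉G (spans⇒depends i∉K
      (InCI⇒spans-reflected M ci (depends⇒spans i∉jK
        (j , K , x∈⁅x⁆∪p j K , q⊆p∪q ⁅ j ⁆ K , j∉K , ij∉G)))))

theorem2p1 : (n : ℕ) → 1 ≤ n →
    ((G : Family n) → SymFamily G →
      ((Σ (Matroid n) (λ M → Loopless M × Represents G M) → MCI G × SG G)
       × (MCI G × SG G → Σ (Matroid n) (λ M → Loopless M × Represents G M))))
    × ((M M′ : Matroid n) → Loopless M → Loopless M′ →
      (∀ i j K → Valid i j K → (InCI M i j K → InCI M′ i j K) × (InCI M′ i j K → InCI M i j K)) →
      ∀ X → r M X ≡ r M′ X)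
theorem2p1 n _ =
  (λ G G-sym →
    (λ (M , _ , G≡[[M]]) → represents⇒MCI {M = M} G≡[[M]] , represents⇒SG {M = M} G≡[[M]]) ,
    (λ (G-mci , G-sg) → let open FromFamily G G-sym G-mci G-sg in M , M-loopless , G≡[[M]])) ,
  rank-unique
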